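{- Let $\mathcal{L}$ be a finite meet-semilattice, and for every building set $\mathcal{G}$ of $\mathcal{L}$ define $\chi_{\mathcal{G}}:N(\mathcal{G})\to\mathbb{N}$ by $\chi_{\mathcal{G}}(S)=|\max N(\mathcal{G})_{\ge S}|$, the number of maximal elements (under inclusion) of $\{T\in N(\mathcal{G}): T\supseteq S\}$. Then $(\chi_{\mathcal{G}})_{\mathcal{G}}$ is an $N$-function: whenever $\mathcal{G}_1$ and $\mathcal{G}_2=\mathcal{G}_1\cup\{b\}$ with $b\notin\mathcal{G}_1$ are building sets, writing $F=F_{\mathcal{G}_1}(b)$, for every $S\in N(\mathcal{G}_2)$: $\chi_{\mathcal{G}_2}(S)=\chi_{\mathcal{G}_1}(S)$ if $b\notin S$ and $S\cup F\notin N(\mathcal{G}_1)$; $\chi_{\mathcal{G}_2}(S)=\chi_{\mathcal{G}_1}(S)+\chi_{\mathcal{G}_1}(S\cup F)(|F\setminus S|-1)$ if $b\notin S$ and $S\cup F\in N(\mathcal{G}_1)$; $\chi_{\mathcal{G}_2}(S)=\chi_{\mathcal{G}_1}(S\setminus\{b\}\cup F)\,|F\setminus S|$ if $b\in S$.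
   Context: All posets are finite. A meet-semilattice is a finite poset in which every subset has a greatest lower bound; $\hat0$ is its least element; $\bigvee T$ is the join of $T$ when it exists; $\max X$ is the set of maximal elements of $X$; $[a,b]=\{x:a\le x\le b\}$; products of posets carry the componentwise order. A subset $\mathcal{G}\subset\mathcal{L}\setminus\{\hat0\}$ is a building set if for every $p\ne\hat0$ there is a poset isomorphism $\phi:[\hat0,p]\to\prod_{g\in F_{\mathcal{G}}(p)}[\hat0,g]$ with $\phi(g)=(\hat0,\dots,g,\dots,\hat0)$ for all $g\in F_{\mathcal{G}}(p)$, where $F_{\mathcal{G}}(p)=\max\{g\in\mathcal{G}:g\le p\}$. The nested set complex $N(\mathcal{G})$ is the set of all $S\subset\mathcal{G}$ (including $\emptyset$) such that for every $T\subset S$ with $|T|\ge2$ of pairwise incomparable elements, $\bigvee T$ exists and $\bigvee T\notin\mathcal{G}$; it is ordered by inclusion. -}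

module Defs where

open import Data.Nat using (ℕ; _≥_)
open import Data.Fin using (Fin)
open import Data.Fin.Subset using (Subset; _∈_; _∉_; _⊆_; Nonempty; ∣_∣)
open import Data.Product using (Σ; ∃; _×_)
open import Data.List using (List; length)
import Data.List.Membership.Propositional as LM
open import Data.List.Relation.Unary.Unique.Propositional using (Unique)
open import Relation.Binary.PropositionalEquality using (_≡_; _≢_)
open import Relation.Binary.Definitions using (Decidable)
open import Relation.Binary.Structures using (IsPartialOrder)
open import Relation.Nullary using (¬_)
open import Function.Bundles using (_⇔_)

record FiniteMeetSemilattice : Set₁ where
  field
    n              : ℕ
    _≤_            : Fin n → Fin n → Set
    _≤?_           : Decidable _≤_
    isPartialOrder : IsPartialOrder _≡_ _≤_
    0̂              : Fin n
    0̂-least        : ∀ x → 0̂ ≤ x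
    meets          : ∀ (T : Subset n) → Nonempty T →
                     Σ (Fin n) λ m → (∀ t → t ∈ T → m ≤ t) ×
                                      (∀ u → (∀ t → t ∈ T → u ≤ t) → u ≤ m)

module _ (L : FiniteMeetSemilattice) where
  open FiniteMeetSemilattice L

  IsJoin : Subset n → Fin n → Set
  IsJoin T j = (∀ t → t ∈ T → t ≤ j) × (∀ u → (∀ t → t ∈ T → t ≤ u) → j ≤ u)

  InF : Subset n → Fin n → Fin n → Set
  InF G p g = g ∈ G × g ≤ p × (∀ h → h ∈ G → h ≤ p → g ≤ h → h ≡ g)

  -- Elements of the product ∏_{g ∈ F} [0̂, g] are encoded as functions
  -- f : Fin n → Fin n with f g ≤ g for g ∈ F and f g ≡ 0̂ for g ∉ F.
  InProduct : Subset n → (Fin n → Fin n) → Set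
  InProduct F f = ∀ g → (g ∈ F → f g ≤ g) × (g ∉ F → f g ≡ 0̂)

  IsProductIso : Fin n → Subset n → (Fin n → (Fin n → Fin n)) → Set
  IsProductIso p F φ =
      (∀ x → x ≤ p → InProduct F (φ x))
    × (∀ x y → x ≤ p → y ≤ p → (∀ g → φ x g ≡ φ y g) → x ≡ y)
    × (∀ f → InProduct F f → Σ (Fin n) λ x → x ≤ p × (∀ g → φ x g ≡ f g))
    × (∀ x y → x ≤ p → y ≤ p → (x ≤ y ⇔ (∀ g → g ∈ F → φ x g ≤ φ y g)))
    × (∀ g → g ∈ F → (φ g g ≡ g) × (∀ h → h ∈ F → h ≢ g → φ g h ≡ 0̂))

  IsBuildingSet : Subset n → Set
  IsBuildingSet G =
      0̂ ∉ G
    × (∀ p → p ≢ 0̂ → ∀ (F : Subset n) → (∀ g → g ∈ F ⇔ InF G p g) →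
         Σ (Fin n → (Fin n → Fin n)) λ φ → IsProductIso p F φ)

  IsNested : Subset n → Subset n → Set
  IsNested G S =
      S ⊆ G
    × (∀ T → T ⊆ S → ∣ T ∣ ≥ 2 →
         (∀ x y → x ∈ T → y ∈ T → x ≢ y → ¬ (x ≤ y)) →
         Σ (Fin n) λ j → IsJoin T j × j ∉ G)

  IsMaxNestedAbove : Subset n → Subset n → Subset n → Set
  IsMaxNestedAbove G S T =
      IsNested G T × S ⊆ T × (∀ U → IsNested G U → T ⊆ U → U ≡ T)

HasCard : ∀ {m} → (Subset m → Set) → ℕ → Set
HasCard P k = Σ (List (Subset _)) λ xs →
  Unique xs × (∀ T → (T LM.∈ xs) ⇔ P T) × length xs ≡ k

module _ (L : FiniteMeetSemilattice) where
  open FiniteMeetSemilattice L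
  χ≡ : Subset n → Subset n → ℕ → Set
  χ≡ G S k = HasCard (IsMaxNestedAbove L G S) k

-- The product decomposition of [0̂, b] shows that F is an
-- antichain of at least two elements with join b, so no G₂-nested set contains F. The key tool
-- is the Feichtner–Kozlov property F_G(⋁T) ⊆ T for every antichain T of a G-nested set; with it,
-- a set U ∌ b is G₂-nested iff it is G₁-nested and F ⊈ U, and a set U ∋ b is G₂-nested iff
-- (U ∖ {b}) ∪ F is G₁-nested and F ⊈ U. Consequently the maximal G₂-nested sets above S are
-- the maximal G₁-nested sets above S not containing F, together with the sets (M ∖ {f}) ∪ {b}
-- where M is maximal G₁-nested above (S ∖ {b}) ∪ F and f ∈ F ∖ S; the pair (M, f) is determined
-- by the set. On the G₁ side, the maximal nested sets above S that contain F are exactly those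
-- above S ∪ F.

module Submission where

open import Defs
open import Data.Nat using (ℕ; _+_; _*_; _∸_)
open import Data.Fin using (Fin)
open import Data.Fin.Subset using (Subset; _∈_; _∉_; _∪_; _─_; _-_; ⁅_⁆; ∣_∣)
open import Data.Product using (Σ; _×_)
open import Relation.Binary.PropositionalEquality using (_≡_)
open import Relation.Nullary using (¬_)
open import Function.Bundles using (_⇔_)
open FiniteMeetSemilattice using (n)

open import Data.Nat using (zero; suc)
import Data.Nat as ℕ
open import Data.Nat.Properties using (*-suc; +-assoc; +-identityʳ)
import Data.Nat.Properties as ℕ
open import Data.Bool using () renaming (_≟_ to _≟ᵇ_)
open import Data.Fin using (zero; suc; _≟_)
open import Data.Fin.Properties using (any?; all?; suc-injective)
open import Data.Fin.Induction using (po-noetherian)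
open import Data.Fin.Subset using (inside; outside; _⊆_)
open import Data.Fin.Subset.Properties
  using (x∈⁅y⁆⇒x≡y; x∈⁅x⁆; x∈p∪q⁺; x∈p∪q⁻; p⊆p∪q; ∣p∣≤∣x∷p∣; p─q⊆p; _∈?_; _⊆?_; anySubset?;
         x∈p∧x≢y⇒x∈p-y; x∈p∧x∉q⇒x∈p─q; ⊆-antisym)
open import Data.Vec using (_∷_; []; here; there; tabulate)
open import Data.Vec.Properties using (∷-injectiveʳ; lookup∘tabulate; []=⇒lookup; lookup⇒[]=; ≡-dec)
open import Data.Vec.Functional using (updateAt)
open import Data.Vec.Functional.Properties using (updateAt-updates; updateAt-minimal)
open import Data.List using (List; []; _∷_; length; map; _++_; filter; cartesianProduct)
open import Data.List.Properties using (length-map; length-++)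
open import Data.List.Membership.Propositional using () renaming (_∈_ to _∈ₗ_)
open import Data.List.Membership.Propositional.Properties
  using (∈-map⁺; ∈-map⁻; ∈-++⁺ˡ; ∈-++⁺ʳ; ∈-++⁻; ∈-filter⁺; ∈-filter⁻;
         ∈-cartesianProduct⁺; ∈-cartesianProduct⁻)
open import Data.List.Relation.Unary.Any using (here; there)
import Data.List.Relation.Unary.All as All
import Data.List.Relation.Unary.All.Properties as All
open import Data.List.Relation.Unary.AllPairs using ([]; _∷_)
open import Data.List.Relation.Unary.Unique.Propositional using (Unique)
import Data.List.Relation.Unary.Unique.Propositional.Properties as Unique
open import Data.Product using (∃; ∃₂; _,_; proj₁; proj₂; uncurry)
open import Data.Sum using (_⊎_; inj₁; inj₂; [_,_]′)
import Data.Sum as Sum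
open import Data.Empty using (⊥; ⊥-elim)
open import Function using (_∘′_; const)
open import Function.Bundles using (mk⇔; Equivalence)
open import Function.Construct.Symmetry using (⇔-sym)
open import Induction.WellFounded using (Acc; acc)
open import Relation.Binary.PropositionalEquality using (_≢_; refl; sym; trans; cong; cong₂; subst; subst₂)
open import Relation.Binary.Structures using (IsPartialOrder)
open import Relation.Nullary using (Dec; yes; no; does)
open import Relation.Nullary.Decidable using (_×-dec_; _→-dec_; ¬?; decidable-stable; dec-true)
open import Relation.Unary using (Decidable)

open Equivalence

private variable
  m : ℕ
  A B : Set

x∈p─q⇒x∉q : ∀ {x : Fin m} (p q : Subset m) → x ∈ p ─ q → x ∉ q
x∈p─q⇒x∉q (inside ∷ p) (outside ∷ q) here    ()
x∈p─q⇒x∉q (_ ∷ p)      (inside ∷ q)  (there x∈p─q) (there x∈q) = x∈p─q⇒x∉q p q x∈p─q x∈q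
x∈p─q⇒x∉q (_ ∷ p)      (outside ∷ q) (there x∈p─q) (there x∈q) = x∈p─q⇒x∉q p q x∈p─q x∈q

x∈p─q⁻ : ∀ {x : Fin m} (p q : Subset m) → x ∈ p ─ q → x ∈ p × x ∉ q
x∈p─q⁻ p q x∈p─q = p─q⊆p p q x∈p─q , x∈p─q⇒x∉q p q x∈p─q

x∈p-y⁻ : ∀ {x y : Fin m} (p : Subset m) → x ∈ p - y → x ∈ p × x ≢ y
x∈p-y⁻ {y = y} p x∈p-y with x∈p─q⁻ p ⁅ y ⁆ x∈p-y
... | x∈p , x∉⁅y⁆ = x∈p , λ { refl → x∉⁅y⁆ (x∈⁅x⁆ y) }

y∈p∪⁅y⁆ : ∀ (p : Subset m) y → y ∈ p ∪ ⁅ y ⁆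
y∈p∪⁅y⁆ p y = x∈p∪q⁺ (inj₂ (x∈⁅x⁆ y))

x∈p∪⁅y⁆⁻ : ∀ {x y : Fin m} (p : Subset m) → x ∈ p ∪ ⁅ y ⁆ → x ∈ p ⊎ x ≡ y
x∈p∪⁅y⁆⁻ {y = y} p x∈ with x∈p∪q⁻ p ⁅ y ⁆ x∈
... | inj₁ x∈p = inj₁ x∈p
... | inj₂ x∈⁅y⁆ = inj₂ (x∈⁅y⁆⇒x≡y y x∈⁅y⁆)

select : {P : Fin m → Set} → Decidable P → Subset m
select P? = tabulate (λ x → does (P? x))

∈-select⁺ : ∀ {x : Fin m} {P : Fin m → Set} (P? : Decidable P) → P x → x ∈ select P?
∈-select⁺ {x = x} P? px = lookup⇒[]= x _ (trans (lookup∘tabulate _ x) (dec-true (P? x) px))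

∈-select⁻ : ∀ {x : Fin m} {P : Fin m → Set} (P? : Decidable P) → x ∈ select P? → P x
∈-select⁻ {x = x} P? x∈ with P? x | trans (sym ([]=⇒lookup x∈)) (lookup∘tabulate _ x)
... | yes px | _  = px
... | no _   | ()

AtLeastTwo : Subset m → Set
AtLeastTwo T = ∃₂ λ x y → x ∈ T × y ∈ T × x ≢ y

x∈p⇒∣p∣≥1 : ∀ {x : Fin m} {p : Subset m} → x ∈ p → 1 ℕ.≤ ∣ p ∣
x∈p⇒∣p∣≥1 {p = inside ∷ p} here        = ℕ.s≤s ℕ.z≤n
x∈p⇒∣p∣≥1 {p = s ∷ p}      (there x∈p) = ℕ.≤-trans (x∈p⇒∣p∣≥1 x∈p) (∣p∣≤∣x∷p∣ s p)

∣p∣≥1⇒x∈p : ∀ (p : Subset m) → 1 ℕ.≤ ∣ p ∣ → ∃ (_∈ p)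
∣p∣≥1⇒x∈p (inside ∷ p)  _       = zero , here
∣p∣≥1⇒x∈p (outside ∷ p) ∣p∣≥1 with ∣p∣≥1⇒x∈p p ∣p∣≥1
... | x , x∈p = suc x , there x∈p

AtLeastTwo⇒∣p∣≥2 : {p : Subset m} → AtLeastTwo p → 2 ℕ.≤ ∣ p ∣
AtLeastTwo⇒∣p∣≥2 {p = inside ∷ p} (zero  , zero  , _ , _ , 0≢0) = ⊥-elim (0≢0 refl)
AtLeastTwo⇒∣p∣≥2 {p = inside ∷ p} (zero  , suc y , _ , there y∈p , _) = ℕ.s≤s (x∈p⇒∣p∣≥1 y∈p)
AtLeastTwo⇒∣p∣≥2 {p = inside ∷ p} (suc x , zero  , there x∈p , _ , _) = ℕ.s≤s (x∈p⇒∣p∣≥1 x∈p)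
AtLeastTwo⇒∣p∣≥2 {p = s ∷ p} (suc x , suc y , there x∈p , there y∈p , sx≢sy) =
  ℕ.≤-trans (AtLeastTwo⇒∣p∣≥2 (x , y , x∈p , y∈p , λ x≡y → sx≢sy (cong suc x≡y))) (∣p∣≤∣x∷p∣ s p)

∣p∣≥2⇒AtLeastTwo : ∀ (p : Subset m) → 2 ℕ.≤ ∣ p ∣ → AtLeastTwo p
∣p∣≥2⇒AtLeastTwo (inside ∷ p) (ℕ.s≤s ∣p∣≥1) with ∣p∣≥1⇒x∈p p ∣p∣≥1
... | y , y∈p = zero , suc y , here , there y∈p , λ ()
∣p∣≥2⇒AtLeastTwo (outside ∷ p) ∣p∣≥2 with ∣p∣≥2⇒AtLeastTwo p ∣p∣≥2
... | x , y , x∈p , y∈p , x≢y =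
  suc x , suc y , there x∈p , there y∈p , λ sx≡sy → x≢y (suc-injective sx≡sy)

AtLeastTwo-other : {T : Subset m} → AtLeastTwo T → ∀ z → ∃ λ t → t ∈ T × t ≢ z
AtLeastTwo-other (x , y , x∈T , y∈T , x≢y) z with x ≟ z
... | yes refl = y , y∈T , λ y≡x → x≢y (sym y≡x)
... | no x≢z   = x , x∈T , x≢z

data Size {m} (T : Subset m) : Set where
  empty     : (∀ x → x ∉ T) → Size T
  singleton : ∀ t → t ∈ T → (∀ x → x ∈ T → x ≡ t) → Size T
  several   : AtLeastTwo T → Size T

size : ∀ (T : Subset m) → Size T
size T with any? (_∈? T)
... | no ∄x = empty λ x x∈T → ∄x (x , x∈T)
... | yes (t , t∈T) with any? (λ x → (x ∈? T) ×-dec ¬? (x ≟ t))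
...   | yes (x , x∈T , x≢t) = several (x , t , x∈T , t∈T , x≢t)
...   | no ∄x = singleton t t∈T λ x x∈T → decidable-stable (x ≟ t) λ x≢t → ∄x (x , x∈T , x≢t)

HasCardIn : (A : Set) → (A → Set) → ℕ → Set
HasCardIn A P k = Σ (List A) λ xs → Unique xs × (∀ a → a ∈ₗ xs ⇔ P a) × length xs ≡ k

HasCardIn-cong : {P Q : A → Set} {k : ℕ} → (∀ a → P a ⇔ Q a) → HasCardIn A P k → HasCardIn A Q k
HasCardIn-cong P⇔Q (xs , xs! , xs⇔P , ∣xs∣) =
  xs , xs! , (λ a → mk⇔ (to (P⇔Q a) ∘′ to (xs⇔P a)) (from (xs⇔P a) ∘′ from (P⇔Q a))) , ∣xs∣

HasCardIn-empty : {P : A → Set} {k : ℕ} → (∀ a → ¬ P a) → HasCardIn A P k → k ≡ 0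
HasCardIn-empty ¬P ([]     , _ , _     , ∣xs∣) = sym ∣xs∣
HasCardIn-empty ¬P (x ∷ xs , _ , xs⇔P , _)    = ⊥-elim (¬P x (to (xs⇔P x) (here refl)))

HasCardIn-⊎ : {P Q : A → Set} {k l : ℕ} → (∀ a → P a → Q a → ⊥) →
              HasCardIn A P k → HasCardIn A Q l → HasCardIn A (λ a → P a ⊎ Q a) (k + l)
HasCardIn-⊎ P∩Q=∅ (xs , xs! , xs⇔P , ∣xs∣) (ys , ys! , ys⇔Q , ∣ys∣) =
  xs ++ ys ,
  Unique.++⁺ xs! ys! (λ (a∈xs , a∈ys) → P∩Q=∅ _ (to (xs⇔P _) a∈xs) (to (ys⇔Q _) a∈ys)) ,
  (λ a → mk⇔ (Sum.map (to (xs⇔P a)) (to (ys⇔Q a)) ∘′ ∈-++⁻ xs)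
             [ ∈-++⁺ˡ ∘′ from (xs⇔P a) , ∈-++⁺ʳ xs ∘′ from (ys⇔Q a) ]′) ,
  trans (length-++ xs) (cong₂ _+_ ∣xs∣ ∣ys∣)

Unique-map⁺ : ∀ (f : A → B) {xs} → (∀ {a a′} → a ∈ₗ xs → a′ ∈ₗ xs → f a ≡ f a′ → a ≡ a′) →
              Unique xs → Unique (map f xs)
Unique-map⁺ f         f-inj []             = []
Unique-map⁺ f {x ∷ _} f-inj (x∉xs ∷ xs!) =
  All.map⁺ (All.tabulate λ y∈xs fx≡fy → All.lookup x∉xs y∈xs (f-inj (here refl) (there y∈xs) fx≡fy)) ∷
  Unique-map⁺ f (λ a∈xs a′∈xs → f-inj (there a∈xs) (there a′∈xs)) xs!

HasCardIn-image : {P : A → Set} {k : ℕ} (f : A → B) → (∀ {a a′} → P a → P a′ → f a ≡ f a′ → a ≡ a′) →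
                  HasCardIn A P k → HasCardIn B (λ b → ∃ λ a → P a × b ≡ f a) k
HasCardIn-image f f-inj (xs , xs! , xs⇔P , ∣xs∣) =
  map f xs ,
  Unique-map⁺ f (λ a∈xs a′∈xs → f-inj (to (xs⇔P _) a∈xs) (to (xs⇔P _) a′∈xs)) xs! ,
  (λ b → mk⇔ (λ b∈ → let (a , a∈xs , b≡fa) = ∈-map⁻ f b∈ in a , to (xs⇔P a) a∈xs , b≡fa)
             (λ { (a , Pa , refl) → ∈-map⁺ f (from (xs⇔P a) Pa) })) ,
  trans (length-map f xs) ∣xs∣

length-cartesianProduct : ∀ (xs : List A) (ys : List B) → length (cartesianProduct xs ys) ≡ length xs * length ys
length-cartesianProduct []       ys = refl
length-cartesianProduct (x ∷ xs) ys = trans (length-++ (map (x ,_) ys))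
  (cong₂ _+_ (length-map (x ,_) ys) (length-cartesianProduct xs ys))

HasCardIn-× : {P : A → Set} {Q : B → Set} {k l : ℕ} →
              HasCardIn A P k → HasCardIn B Q l → HasCardIn (A × B) (λ (a , b) → P a × Q b) (k * l)
HasCardIn-× (xs , xs! , xs⇔P , ∣xs∣) (ys , ys! , ys⇔Q , ∣ys∣) =
  cartesianProduct xs ys ,
  Unique.cartesianProduct⁺ xs! ys! ,
  (λ (a , b) → mk⇔ (λ ab∈ → let (a∈xs , b∈ys) = ∈-cartesianProduct⁻ xs ys ab∈
                             in to (xs⇔P a) a∈xs , to (ys⇔Q b) b∈ys)
                   (λ (Pa , Qb) → ∈-cartesianProduct⁺ (from (xs⇔P a) Pa) (from (ys⇔Q b) Qb))) ,
  trans (length-cartesianProduct xs ys) (cong₂ _*_ ∣xs∣ ∣ys∣)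

elements : Subset m → List (Fin m)
elements []            = []
elements (inside ∷ p)  = zero ∷ map suc (elements p)
elements (outside ∷ p) = map suc (elements p)

∈-elements⇔ : ∀ (p : Subset m) x → x ∈ₗ elements p ⇔ x ∈ p
∈-elements⇔ p x = mk⇔ (∈-elements⁻ p) (∈-elements⁺ p)
  where
  ∈-elements⁺ : ∀ (p : Subset m) {x} → x ∈ p → x ∈ₗ elements p
  ∈-elements⁺ (inside ∷ p)  here        = here refl
  ∈-elements⁺ (inside ∷ p)  (there x∈p) = there (∈-map⁺ suc (∈-elements⁺ p x∈p))
  ∈-elements⁺ (outside ∷ p) (there x∈p) = ∈-map⁺ suc (∈-elements⁺ p x∈p)
  ∈-elements⁻ : ∀ (p : Subset m) {x} → x ∈ₗ elements p → x ∈ p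
  ∈-elements⁻ (inside ∷ p)  (here refl) = here
  ∈-elements⁻ (inside ∷ p)  (there x∈)  with ∈-map⁻ suc x∈
  ... | _ , y∈ , refl = there (∈-elements⁻ p y∈)
  ∈-elements⁻ (outside ∷ p) x∈          with ∈-map⁻ suc x∈
  ... | _ , y∈ , refl = there (∈-elements⁻ p y∈)

elements-unique : ∀ (p : Subset m) → Unique (elements p)
elements-unique []            = []
elements-unique (inside ∷ p)  =
  All.map⁺ (All.tabulate λ _ ()) ∷ Unique.map⁺ suc-injective (elements-unique p)
elements-unique (outside ∷ p) = Unique.map⁺ suc-injective (elements-unique p)

length-elements : ∀ (p : Subset m) → length (elements p) ≡ ∣ p ∣
length-elements []            = refl
length-elements (inside ∷ p)  = cong suc (trans (length-map suc (elements p)) (length-elements p))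
length-elements (outside ∷ p) = trans (length-map suc (elements p)) (length-elements p)

HasCardIn-∈ : ∀ (p : Subset m) → HasCardIn (Fin m) (_∈ p) ∣ p ∣
HasCardIn-∈ p = elements p , elements-unique p , ∈-elements⇔ p , length-elements p

subsets : ∀ m → List (Subset m)
subsets zero    = [] ∷ []
subsets (suc m) = map (inside ∷_) (subsets m) ++ map (outside ∷_) (subsets m)

∈-subsets : ∀ (p : Subset m) → p ∈ₗ subsets m
∈-subsets []                    = here refl
∈-subsets (inside ∷ p)          = ∈-++⁺ˡ (∈-map⁺ (inside ∷_) (∈-subsets p))
∈-subsets {suc m} (outside ∷ p) = ∈-++⁺ʳ (map (inside ∷_) (subsets m)) (∈-map⁺ (outside ∷_) (∈-subsets p))

subsets-unique : ∀ m → Unique (subsets m)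
subsets-unique zero    = All.[] ∷ []
subsets-unique (suc m) =
  Unique.++⁺ (Unique.map⁺ ∷-injectiveʳ (subsets-unique m)) (Unique.map⁺ ∷-injectiveʳ (subsets-unique m))
             heads-differ
  where
  heads-differ : ∀ {v} → v ∈ₗ map (inside ∷_) (subsets m) × v ∈ₗ map (outside ∷_) (subsets m) → ⊥
  heads-differ (v∈ , v∈′) with ∈-map⁻ (inside ∷_) v∈ | ∈-map⁻ (outside ∷_) v∈′
  ... | _ , _ , refl | _ , _ , ()

hasCard : {P : Subset m → Set} → Decidable P → ∃ (HasCard P)
hasCard {m} P? =
  _ , filter P? (subsets m) , Unique.filter⁺ P? (subsets-unique m) ,
  (λ p → mk⇔ (proj₂ ∘′ ∈-filter⁻ P? {xs = subsets m}) (∈-filter⁺ P? (∈-subsets p))) , refl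

⊈⇒∃∉ : ∀ {p q : Subset m} → ¬ p ⊆ q → ∃ λ x → x ∈ p × x ∉ q
⊈⇒∃∉ {p = p} {q} p⊈q with any? (λ x → x ∈? p ×-dec ¬? (x ∈? q))
... | yes x∈p─q = x∈p─q
... | no ∄x     = ⊥-elim (p⊈q λ {x} x∈p → decidable-stable (x ∈? q) λ x∉q → ∄x (x , x∈p , x∉q))

a+c*s≡a+c+c*[s∸1] : ∀ a c s → 1 ℕ.≤ s → a + c * s ≡ a + c + c * (s ∸ 1)
a+c*s≡a+c+c*[s∸1] a c (suc s) _ = trans (cong (a +_) (*-suc c s)) (sym (+-assoc a c (c * s)))

module Semilattice (L : FiniteMeetSemilattice) where
  open FiniteMeetSemilattice L renaming (n to N)
  open IsPartialOrder isPartialOrder using (antisym) renaming (refl to ≤-refl; trans to ≤-trans)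

  private variable
    x y g j p : Fin N
    G T U : Subset N

  Antichain : Subset N → Set
  Antichain T = ∀ x y → x ∈ T → y ∈ T → x ≢ y → ¬ x ≤ y

  Antichain-⊆ : T ⊆ U → Antichain U → Antichain T
  Antichain-⊆ T⊆U U-anti x y x∈T y∈T = U-anti x y (T⊆U x∈T) (T⊆U y∈T)

  x≤0̂⇒x≡0̂ : x ≤ 0̂ → x ≡ 0̂
  x≤0̂⇒x≡0̂ x≤0̂ = antisym x≤0̂ (0̂-least _)

  UpperBound : Subset N → Fin N → Set
  UpperBound X u = ∀ x → x ∈ X → x ≤ u

  upperBound? : ∀ X u → Dec (UpperBound X u)
  upperBound? X u = all? λ x → x ∈? X →-dec x ≤? u

  boundedJoin : ∀ X p → UpperBound X p → ∃ λ j → IsJoin L X j × j ≤ p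
  boundedJoin X p X≤p with meets (select (upperBound? X)) (p , ∈-select⁺ (upperBound? X) X≤p)
  ... | j , j≤ , j-greatest =
    j , ((λ x x∈X → j-greatest x λ u u∈ → ∈-select⁻ (upperBound? X) u∈ x x∈X) ,
         (λ u X≤u → j≤ u (∈-select⁺ (upperBound? X) X≤u))) ,
    j≤ p (∈-select⁺ (upperBound? X) X≤p)

  IsJoin-unique : IsJoin L T x → IsJoin L T y → x ≡ y
  IsJoin-unique (T≤x , x-least) (T≤y , y-least) = antisym (x-least _ T≤y) (y-least _ T≤x)

  IsJoin-∅ : (∀ x → x ∉ T) → IsJoin L T j → j ≡ 0̂
  IsJoin-∅ T=∅ (_ , j-least) = x≤0̂⇒x≡0̂ (j-least 0̂ λ x x∈T → ⊥-elim (T=∅ x x∈T))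

  IsJoin-singleton : x ∈ T → (∀ y → y ∈ T → y ≡ x) → IsJoin L T j → j ≡ x
  IsJoin-singleton x∈T T=⁅x⁆ (T≤j , j-least) =
    antisym (j-least _ λ y y∈T → subst (_≤ _) (sym (T=⁅x⁆ y y∈T)) ≤-refl) (T≤j _ x∈T)

  antichain-join≰member : AtLeastTwo T → Antichain T → IsJoin L T j → g ∈ T → ¬ j ≤ g
  antichain-join≰member T≥2 T-anti (T≤j , _) g∈T j≤g with AtLeastTwo-other T≥2 _
  ... | t , t∈T , t≢g = T-anti t _ t∈T g∈T t≢g (≤-trans (T≤j t t∈T) j≤g)

  InF? : ∀ G p g → Dec (InF L G p g)
  InF? G p g = g ∈? G ×-dec g ≤? p ×-dec all? λ h → h ∈? G →-dec h ≤? p →-dec g ≤? h →-dec h ≟ g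

  InF-maximal : ∀ {g g′} → InF L G p g → InF L G p g′ → g ≤ g′ → g′ ≡ g
  InF-maximal (_ , _ , g-max) (g′∈G , g′≤p , _) g≤g′ = g-max _ g′∈G g′≤p g≤g′

  InF-antichain : ∀ {F} → (∀ g → g ∈ F ⇔ InF L G p g) → Antichain F
  InF-antichain F⇔ x y x∈F y∈F x≢y x≤y = x≢y (sym (InF-maximal (to (F⇔ x) x∈F) (to (F⇔ y) y∈F) x≤y))

  InF-above : g ∈ G → g ≤ p → ∃ λ g′ → InF L G p g′ × g ≤ g′
  InF-above {G = G} {p = p} = go _ (po-noetherian isPartialOrder _)
    where
    go : ∀ x → Acc _ x → x ∈ G → x ≤ p → ∃ λ g′ → InF L G p g′ × x ≤ g′
    go x (acc above) x∈G x≤p with any? (λ y → y ∈? G ×-dec y ≤? p ×-dec x ≤? y ×-dec ¬? (y ≟ x))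
    ... | yes (y , y∈G , y≤p , x≤y , y≢x) =
      let g′ , g′-InF , y≤g′ = go y (above (x≤y , λ x≡y → y≢x (sym x≡y))) y∈G y≤p
      in g′ , g′-InF , ≤-trans x≤y y≤g′
    ... | no ∄y = x , (x∈G , x≤p , x-max) , ≤-refl
      where
      x-max : ∀ h → h ∈ G → h ≤ p → x ≤ h → h ≡ x
      x-max h h∈G h≤p x≤h = decidable-stable (h ≟ x) λ h≢x → ∄y (h , h∈G , h≤p , x≤h , h≢x)

  IsNested-⊆ : IsNested L G U → T ⊆ U → IsNested L G T
  IsNested-⊆ (U⊆G , U-joins) T⊆U =
    (λ x∈T → U⊆G (T⊆U x∈T)) , λ V V⊆T → U-joins V (λ x∈V → T⊆U (V⊆T x∈V))

  NestedJoins : Subset N → Subset N → Set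
  NestedJoins G U = ∀ T → T ⊆ U → AtLeastTwo T → Antichain T → ∃ λ j → IsJoin L T j × j ∉ G

  IsNested-joins : IsNested L G U → NestedJoins G U
  IsNested-joins (_ , U-joins) T T⊆U T≥2 = U-joins T T⊆U (AtLeastTwo⇒∣p∣≥2 T≥2)

  mkNested : U ⊆ G → NestedJoins G U → IsNested L G U
  mkNested U⊆G U-joins = U⊆G , λ T T⊆U ∣T∣≥2 → U-joins T T⊆U (∣p∣≥2⇒AtLeastTwo T ∣T∣≥2)

  private
    ∀-subset? : {P : Subset N → Set} → (∀ T → Dec (P T)) → Dec (∀ T → P T)
    ∀-subset? P? with anySubset? (λ T → ¬? (P? T))
    ... | yes (T , ¬PT) = no λ ∀P → ¬PT (∀P T)
    ... | no ∄T         = yes λ T → decidable-stable (P? T) λ ¬PT → ∄T (T , ¬PT)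

    antichain? : ∀ T → Dec (Antichain T)
    antichain? T = all? λ x → all? λ y → x ∈? T →-dec y ∈? T →-dec ¬? (x ≟ y) →-dec ¬? (x ≤? y)

    isJoin? : ∀ T j → Dec (IsJoin L T j)
    isJoin? T j = upperBound? T j ×-dec all? λ u → upperBound? T u →-dec j ≤? u

  IsNested? : ∀ G U → Dec (IsNested L G U)
  IsNested? G U = U ⊆? G ×-dec ∀-subset? λ T →
    T ⊆? U →-dec 2 ℕ.≤? ∣ T ∣ →-dec antichain? T →-dec any? λ j → isJoin? T j ×-dec ¬? (j ∈? G)

  IsMaxNestedAbove? : ∀ G S T → Dec (IsMaxNestedAbove L G S T)
  IsMaxNestedAbove? G S T = IsNested? G T ×-dec S ⊆? T ×-dec ∀-subset? λ U →
    IsNested? G U →-dec T ⊆? U →-dec ≡-dec _≟ᵇ_ U T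

  module Coordinates {G : Subset N} (G-building : IsBuildingSet L G) {p : Fin N} (p≢0̂ : p ≢ 0̂)
                     {F : Subset N} (F⇔ : ∀ g → g ∈ F ⇔ InF L G p g) where
    φ : Fin N → Fin N → Fin N
    φ = proj₁ (proj₂ G-building p p≢0̂ F F⇔)

    private
      iso : IsProductIso L p F φ
      iso = proj₂ (proj₂ G-building p p≢0̂ F F⇔)

    F≤p : g ∈ F → g ≤ p
    F≤p g∈F = proj₁ (proj₂ (to (F⇔ _) g∈F))

    φ-≤ : x ≤ p → g ∈ F → φ x g ≤ g
    φ-≤ x≤p g∈F = proj₁ (proj₁ iso _ x≤p _) g∈F

    φ-mono : x ≤ p → y ≤ p → x ≤ y → g ∈ F → φ x g ≤ φ y g
    φ-mono x≤p y≤p x≤y g∈F = to (proj₁ (proj₂ (proj₂ (proj₂ iso))) _ _ x≤p y≤p) x≤y _ g∈F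

    φ-reflects-≤ : x ≤ p → y ≤ p → (∀ g → g ∈ F → φ x g ≤ φ y g) → x ≤ y
    φ-reflects-≤ x≤p y≤p = from (proj₁ (proj₂ (proj₂ (proj₂ iso))) _ _ x≤p y≤p)

    φ-injective : x ≤ p → y ≤ p → (∀ g → g ∈ F → φ x g ≡ φ y g) → x ≡ y
    φ-injective x≤p y≤p φx≗φy = antisym
      (φ-reflects-≤ x≤p y≤p λ g g∈F → subst (φ _ g ≤_) (φx≗φy g g∈F) ≤-refl)
      (φ-reflects-≤ y≤p x≤p λ g g∈F → subst (_≤ φ _ g) (φx≗φy g g∈F) ≤-refl)

    φ-unit : g ∈ F → φ g g ≡ g × (∀ h → h ∈ F → h ≢ g → φ g h ≡ 0̂)
    φ-unit = proj₂ (proj₂ (proj₂ (proj₂ iso))) _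

    φ-full : x ≤ p → g ∈ F → g ≤ x → φ x g ≡ g
    φ-full x≤p g∈F g≤x =
      antisym (φ-≤ x≤p g∈F) (subst (_≤ φ _ _) (proj₁ (φ-unit g∈F)) (φ-mono (F≤p g∈F) x≤p g≤x g∈F))

    φ-empty : ∀ {g′} → x ≤ p → g′ ∈ F → x ≤ g′ → g ∈ F → g ≢ g′ → φ x g ≡ 0̂
    φ-empty x≤p g′∈F x≤g′ g∈F g≢g′ =
      x≤0̂⇒x≡0̂ (subst (φ _ _ ≤_) (proj₂ (φ-unit g′∈F) _ g∈F g≢g′) (φ-mono x≤p (F≤p g′∈F) x≤g′ g∈F))

    φ-update : ∀ {v} → x ≤ p → g ∈ F → v ≤ g →
               ∃ λ y → y ≤ p × φ y g ≡ v × (∀ h → h ≢ g → φ y h ≡ φ x h)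
    φ-update {x} {g} {v} x≤p g∈F v≤g with proj₁ (proj₂ (proj₂ iso)) (updateAt (φ x) g (const v)) ∈product
      where
      ∈product : InProduct L F (updateAt (φ x) g (const v))
      ∈product h with h ≟ g
      ... | yes refl = (λ _ → subst (_≤ h) (sym (updateAt-updates h (φ x))) v≤g) , λ h∉F → ⊥-elim (h∉F g∈F)
      ... | no h≢g   = (λ h∈F → subst (_≤ h) (sym (updateAt-minimal h g (φ x) h≢g)) (φ-≤ x≤p h∈F)) ,
                       λ h∉F → trans (updateAt-minimal h g (φ x) h≢g) (proj₂ (proj₁ iso x x≤p h) h∉F)
    ... | y , y≤p , φy≗ = y , y≤p , trans (φy≗ g) (updateAt-updates g (φ x)) ,
                          λ h h≢g → trans (φy≗ h) (updateAt-minimal h g (φ x) h≢g)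

    F-join : IsJoin L F p
    F-join with boundedJoin F p (λ _ → F≤p)
    ... | j , (F≤j , j-least) , j≤p = subst (IsJoin L F) j≡p (F≤j , j-least)
      where
      j≡p : j ≡ p
      j≡p = φ-injective j≤p ≤-refl λ g g∈F →
        trans (φ-full j≤p g∈F (F≤j g g∈F)) (sym (φ-full ≤-refl g∈F (F≤p g∈F)))

    F-atLeastTwo : p ∉ G → AtLeastTwo F
    F-atLeastTwo p∉G with size F
    ... | empty F=∅             = ⊥-elim (p≢0̂ (IsJoin-∅ F=∅ F-join))
    ... | several F≥2           = F≥2
    ... | singleton f f∈F F=⁅f⁆ =
      ⊥-elim (p∉G (subst (_∈ G) (sym (IsJoin-singleton f∈F F=⁅f⁆ F-join)) (proj₁ (to (F⇔ f) f∈F))))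

  _↓_ : Subset N → Fin N → Subset N
  T ↓ g = select λ t → t ∈? T ×-dec t ≤? g

  ∈-↓⁺ : x ∈ T → x ≤ g → x ∈ T ↓ g
  ∈-↓⁺ x∈T x≤g = ∈-select⁺ (λ t → t ∈? _ ×-dec t ≤? _) (x∈T , x≤g)

  ∈-↓⁻ : x ∈ T ↓ g → x ∈ T × x ≤ g
  ∈-↓⁻ = ∈-select⁻ (λ t → t ∈? _ ×-dec t ≤? _)

  join↓≡InF : IsBuildingSet L G → T ⊆ G → IsJoin L T j → InF L G j g → ∀ {k} → IsJoin L (T ↓ g) k → k ≡ g
  join↓≡InF {G} {T} {j} {g} G-building T⊆G (T≤j , j-least) g-InF@(g∈G , g≤j , _) {k} (T↓g≤k , k-least) =
    φ-injective k≤j g≤j λ h h∈F → φk≗φg h h∈F (h ≟ g)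
    where
    j≢0̂ : j ≢ 0̂
    j≢0̂ refl = proj₁ G-building (subst (_∈ G) (x≤0̂⇒x≡0̂ g≤j) g∈G)
    Fⱼ : Subset N
    Fⱼ = select (InF? G j)
    open Coordinates G-building j≢0̂ (λ h → mk⇔ (∈-select⁻ (InF? G j)) (∈-select⁺ (InF? G j)))
    g∈F : g ∈ Fⱼ
    g∈F = ∈-select⁺ (InF? G j) g-InF
    k≤g : k ≤ g
    k≤g = k-least g λ t t∈ → proj₂ (∈-↓⁻ t∈)
    k≤j : k ≤ j
    k≤j = ≤-trans k≤g g≤j
    -- An element of T not below g lies below another element of F_G(j), so its g-th coordinate is 0̂.
    T-coordinate≤k : ∀ t → t ∈ T → φ t g ≤ φ k g
    T-coordinate≤k t t∈T with t ≤? g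
    ... | yes t≤g = φ-mono (T≤j t t∈T) k≤j (T↓g≤k t (∈-↓⁺ t∈T t≤g)) g∈F
    ... | no t≰g with InF-above (T⊆G t∈T) (T≤j t t∈T)
    ... | g′ , g′-InF , t≤g′ =
      subst (_≤ φ k g) (sym (φ-empty (T≤j t t∈T) (∈-select⁺ (InF? G j) g′-InF) t≤g′ g∈F
                                     λ { refl → t≰g t≤g′ }))
            (0̂-least _)
    -- Lowering the g-th coordinate of j to that of k still bounds T, so it does not lower j at all.
    lowered : ∃ λ y → y ≤ j × φ y g ≡ φ k g × (∀ h → h ≢ g → φ y h ≡ φ j h)
    lowered = φ-update ≤-refl g∈F (φ-≤ k≤j g∈F)
    j′ : Fin N
    j′ = proj₁ lowered
    j′≤j : j′ ≤ j
    j′≤j = proj₁ (proj₂ lowered)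
    φj′g≡φkg : φ j′ g ≡ φ k g
    φj′g≡φkg = proj₁ (proj₂ (proj₂ lowered))
    φj′h≡φjh : ∀ h → h ≢ g → φ j′ h ≡ φ j h
    φj′h≡φjh = proj₂ (proj₂ (proj₂ lowered))
    j≤j′ : j ≤ j′
    j≤j′ = j-least j′ λ t t∈T → φ-reflects-≤ (T≤j t t∈T) j′≤j λ h h∈F → T≤j′ t t∈T h h∈F (h ≟ g)
      where
      T≤j′ : ∀ t → t ∈ T → ∀ h → h ∈ Fⱼ → Dec (h ≡ g) → φ t h ≤ φ j′ h
      T≤j′ t t∈T h h∈F (yes refl) = subst (φ t h ≤_) (sym φj′g≡φkg) (T-coordinate≤k t t∈T)
      T≤j′ t t∈T h h∈F (no h≢g)   =
        subst (φ t h ≤_) (sym (φj′h≡φjh h h≢g)) (φ-mono (T≤j t t∈T) ≤-refl (T≤j t t∈T) h∈F)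
    φkg≡g : φ k g ≡ g
    φkg≡g = antisym (φ-≤ k≤j g∈F)
                    (subst₂ _≤_ (φ-full ≤-refl g∈F g≤j) φj′g≡φkg (φ-mono ≤-refl j′≤j j≤j′ g∈F))
    φk≗φg : ∀ h → h ∈ Fⱼ → Dec (h ≡ g) → φ k h ≡ φ g h
    φk≗φg h h∈F (yes refl) = trans φkg≡g (sym (proj₁ (φ-unit g∈F)))
    φk≗φg h h∈F (no h≢g)   = trans (φ-empty k≤j g∈F k≤g h∈F h≢g) (sym (proj₂ (φ-unit g∈F) h h∈F h≢g))

  InF-join∈ : IsBuildingSet L G → IsNested L G U → T ⊆ U → Antichain T → IsJoin L T j → InF L G j g → g ∈ T
  InF-join∈ {G} {U} {T} {j} {g} G-building U-nested T⊆U T-anti T-join g-InF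
    with boundedJoin (T ↓ g) g (λ t t∈ → proj₂ (∈-↓⁻ t∈))
  ... | k , k-join , _
    with join↓≡InF G-building (λ t∈T → proj₁ U-nested (T⊆U t∈T)) T-join g-InF k-join | size (T ↓ g)
  ... | refl | empty T↓g=∅ = ⊥-elim (proj₁ G-building (subst (_∈ G) (IsJoin-∅ T↓g=∅ k-join) (proj₁ g-InF)))
  ... | refl | singleton t t∈ T↓g=⁅t⁆ =
    subst (_∈ T) (sym (IsJoin-singleton t∈ T↓g=⁅t⁆ k-join)) (proj₁ (∈-↓⁻ t∈))
  ... | refl | several T↓g≥2
    with IsNested-joins U-nested (T ↓ g) (λ t∈ → T⊆U (T↓g⊆T t∈)) T↓g≥2 (Antichain-⊆ T↓g⊆T T-anti)
    where
    T↓g⊆T : T ↓ g ⊆ T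
    T↓g⊆T t∈ = proj₁ (∈-↓⁻ t∈)
  ...   | j′ , j′-join , j′∉G = ⊥-elim (j′∉G (subst (_∈ G) (IsJoin-unique k-join j′-join) (proj₁ g-InF)))

module Extension (L : FiniteMeetSemilattice)
               {G₁ : Subset (n L)} {b : Fin (n L)} (G₁-building : IsBuildingSet L G₁) (b∉G₁ : b ∉ G₁)
               (G₂-building : IsBuildingSet L (G₁ ∪ ⁅ b ⁆))
               {F : Subset (n L)} (F⇔ : ∀ g → g ∈ F ⇔ InF L G₁ b g) where
  open FiniteMeetSemilattice L renaming (n to N)
  open Semilattice L
  open IsPartialOrder isPartialOrder using (antisym) renaming (refl to ≤-refl; trans to ≤-trans)

  private variable
    x f j : Fin N
    S T U V W M : Subset N

  G₂ : Subset N
  G₂ = G₁ ∪ ⁅ b ⁆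

  G₁⊆G₂ : x ∈ G₁ → x ∈ G₂
  G₁⊆G₂ x∈G₁ = x∈p∪q⁺ (inj₁ x∈G₁)

  b∈G₂ : b ∈ G₂
  b∈G₂ = y∈p∪⁅y⁆ G₁ b

  ∉G₂ : x ∉ G₁ → x ≢ b → x ∉ G₂
  ∉G₂ x∉G₁ x≢b x∈G₂ with x∈p∪⁅y⁆⁻ G₁ x∈G₂
  ... | inj₁ x∈G₁ = x∉G₁ x∈G₁
  ... | inj₂ x≡b  = x≢b x≡b

  ∈G₂∧≢b⇒∈G₁ : x ∈ G₂ → x ≢ b → x ∈ G₁
  ∈G₂∧≢b⇒∈G₁ x∈G₂ x≢b with x∈p∪⁅y⁆⁻ G₁ x∈G₂
  ... | inj₁ x∈G₁ = x∈G₁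
  ... | inj₂ x≡b  = ⊥-elim (x≢b x≡b)

  b≢0̂ : b ≢ 0̂
  b≢0̂ b≡0̂ = proj₁ G₂-building (subst (_∈ G₂) b≡0̂ b∈G₂)

  F≤b : f ∈ F → f ≤ b
  F≤b f∈F = proj₁ (proj₂ (to (F⇔ _) f∈F))

  F⊆G₁ : F ⊆ G₁
  F⊆G₁ f∈F = proj₁ (to (F⇔ _) f∈F)

  F∌b : f ∈ F → f ≢ b
  F∌b f∈F refl = b∉G₁ (F⊆G₁ f∈F)

  F-join : IsJoin L F b
  F-join = Coordinates.F-join G₁-building b≢0̂ F⇔

  F-antichain : Antichain F
  F-antichain = InF-antichain F⇔

  F-atLeastTwo : AtLeastTwo F
  F-atLeastTwo = Coordinates.F-atLeastTwo G₁-building b≢0̂ F⇔ b∉G₁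

  Nested₁ Nested₂ : Subset N → Set
  Nested₁ = IsNested L G₁
  Nested₂ = IsNested L G₂

  b∉Nested₁ : Nested₁ U → b ∉ U
  b∉Nested₁ U-nested b∈U = b∉G₁ (proj₁ U-nested b∈U)

  Nested₂⇒F⊈ : Nested₂ U → ¬ F ⊆ U
  Nested₂⇒F⊈ U-nested F⊆U with IsNested-joins U-nested F F⊆U F-atLeastTwo F-antichain
  ... | j , F-join′ , j∉G₂ = j∉G₂ (subst (_∈ G₂) (IsJoin-unique F-join F-join′) b∈G₂)

  join≡b⇒F⊆ : Nested₁ U → T ⊆ U → Antichain T → IsJoin L T b → F ⊆ T
  join≡b⇒F⊆ U-nested T⊆U T-anti T-join f∈F =
    InF-join∈ G₁-building U-nested T⊆U T-anti T-join (to (F⇔ _) f∈F)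

  Nested₂⇒Nested₁ : Nested₂ U → b ∉ U → Nested₁ U
  Nested₂⇒Nested₁ U-nested b∉U =
    (λ x∈U → ∈G₂∧≢b⇒∈G₁ (proj₁ U-nested x∈U) λ { refl → b∉U x∈U }) ,
    λ T T⊆U ∣T∣≥2 T-anti → let j , T-join , j∉G₂ = proj₂ U-nested T T⊆U ∣T∣≥2 T-anti
                           in j , T-join , λ j∈G₁ → j∉G₂ (G₁⊆G₂ j∈G₁)

  Nested₁⇒Nested₂ : Nested₁ U → ¬ F ⊆ U → Nested₂ U
  Nested₁⇒Nested₂ {U = U} U-nested F⊈U = mkNested (λ x∈U → G₁⊆G₂ (proj₁ U-nested x∈U)) joins
    where
    joins : NestedJoins G₂ U
    joins T T⊆U T≥2 T-anti with IsNested-joins U-nested T T⊆U T≥2 T-anti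
    ... | j , T-join , j∉G₁ = j , T-join , ∉G₂ j∉G₁ λ { refl →
      F⊈U λ f∈F → T⊆U (join≡b⇒F⊆ U-nested T⊆U T-anti T-join f∈F) }

  expand : Subset N → Subset N
  expand U = (U - b) ∪ F

  ∈-expand⁺ˡ : x ∈ U → x ≢ b → x ∈ expand U
  ∈-expand⁺ˡ x∈U x≢b = x∈p∪q⁺ (inj₁ (x∈p∧x≢y⇒x∈p-y x∈U x≢b))

  ∈-expand⁺ʳ : F ⊆ expand U
  ∈-expand⁺ʳ f∈F = x∈p∪q⁺ (inj₂ f∈F)

  ∈-expand⁻ : x ∈ expand U → (x ∈ U × x ≢ b) ⊎ x ∈ F
  ∈-expand⁻ {U = U} x∈ with x∈p∪q⁻ (U - b) F x∈
  ... | inj₁ x∈U-b = inj₁ (x∈p-y⁻ U x∈U-b)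
  ... | inj₂ x∈F   = inj₂ x∈F

  ⊆-expand : T ⊆ U → b ∉ T → T ⊆ expand U
  ⊆-expand T⊆U b∉T x∈T = ∈-expand⁺ˡ (T⊆U x∈T) λ { refl → b∉T x∈T }

  Nested₂⇒expand⊆G₁ : Nested₂ U → expand U ⊆ G₁
  Nested₂⇒expand⊆G₁ U-nested x∈ with ∈-expand⁻ x∈
  ... | inj₁ (x∈U , x≢b) = ∈G₂∧≢b⇒∈G₁ (proj₁ U-nested x∈U) x≢b
  ... | inj₂ x∈F         = F⊆G₁ x∈F

  Uncovered : Subset N → Fin N → Set
  Uncovered T x = x ∈ F × ∀ t → t ∈ T - b → ¬ x ≤ t

  uncovered? : ∀ T → Decidable (Uncovered T)
  uncovered? T x = x ∈? F ×-dec all? λ t → t ∈? (T - b) →-dec ¬? (x ≤? t)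

  -- When b lies in an antichain T, it may be traded for the elements of F lying
  -- below no other element of T, without changing the join.
  replaceByF : Subset N → Subset N
  replaceByF T = (T - b) ∪ select (uncovered? T)

  ∈-replaceByF⁺ˡ : x ∈ T → x ≢ b → x ∈ replaceByF T
  ∈-replaceByF⁺ˡ x∈T x≢b = x∈p∪q⁺ (inj₁ (x∈p∧x≢y⇒x∈p-y x∈T x≢b))

  ∈-replaceByF⁺ʳ : Uncovered T x → x ∈ replaceByF T
  ∈-replaceByF⁺ʳ {T = T} x-uncovered = x∈p∪q⁺ (inj₂ (∈-select⁺ (uncovered? T) x-uncovered))

  ∈-replaceByF⁻ : x ∈ replaceByF T → (x ∈ T × x ≢ b) ⊎ Uncovered T x
  ∈-replaceByF⁻ {T = T} x∈ with x∈p∪q⁻ (T - b) _ x∈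
  ... | inj₁ x∈T-b = inj₁ (x∈p-y⁻ T x∈T-b)
  ... | inj₂ x∈sel = inj₂ (∈-select⁻ (uncovered? T) x∈sel)

  replaceByF-⊆ : T ⊆ U → replaceByF T ⊆ expand U
  replaceByF-⊆ T⊆U x∈ with ∈-replaceByF⁻ x∈
  ... | inj₁ (x∈T , x≢b) = ∈-expand⁺ˡ (T⊆U x∈T) x≢b
  ... | inj₂ (x∈F , _)   = ∈-expand⁺ʳ x∈F

  replaceByF-antichain : b ∈ T → Antichain T → Antichain (replaceByF T)
  replaceByF-antichain b∈T T-anti x y x∈ y∈ x≢y x≤y with ∈-replaceByF⁻ x∈ | ∈-replaceByF⁻ y∈
  ... | inj₁ (x∈T , _)   | inj₁ (y∈T , _)   = T-anti x y x∈T y∈T x≢y x≤y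
  ... | inj₁ (x∈T , x≢b) | inj₂ (y∈F , _)   = T-anti x b x∈T b∈T x≢b (≤-trans x≤y (F≤b y∈F))
  ... | inj₂ (_ , x≰T)   | inj₁ (y∈T , y≢b) = x≰T y (x∈p∧x≢y⇒x∈p-y y∈T y≢b) x≤y
  ... | inj₂ (x∈F , _)   | inj₂ (y∈F , _)   = F-antichain x y x∈F y∈F x≢y x≤y

  replaceByF-atLeastTwo : b ∈ T → AtLeastTwo T → Antichain T → AtLeastTwo (replaceByF T)
  replaceByF-atLeastTwo {T = T} b∈T T≥2 T-anti with AtLeastTwo-other T≥2 b
  ... | t , t∈T , t≢b with size (T - b)
  ... | empty T-b=∅ = ⊥-elim (T-b=∅ t (x∈p∧x≢y⇒x∈p-y t∈T t≢b))
  ... | several (x , y , x∈ , y∈ , x≢y) =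
    x , y , x∈p∪q⁺ (inj₁ x∈) , x∈p∪q⁺ (inj₁ y∈) , x≢y
  ... | singleton t′ t′∈ T-b=⁅t′⁆ with any? (λ f → f ∈? F ×-dec ¬? (f ≤? t))
  ...   | no ∄f = ⊥-elim (T-anti b t b∈T t∈T (λ b≡t → t≢b (sym b≡t))
                    (proj₂ F-join t λ f f∈F → decidable-stable (f ≤? t) λ f≰t → ∄f (f , f∈F , f≰t)))
  ...   | yes (f , f∈F , f≰t) =
    f , t , ∈-replaceByF⁺ʳ (f∈F , f≰T-b) , ∈-replaceByF⁺ˡ t∈T t≢b ,
    λ { refl → T-anti t b t∈T b∈T t≢b (F≤b f∈F) }
    where
    f≰T-b : ∀ u → u ∈ T - b → ¬ f ≤ u
    f≰T-b u u∈ with T-b=⁅t′⁆ u u∈ | T-b=⁅t′⁆ t (x∈p∧x≢y⇒x∈p-y t∈T t≢b)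
    ... | refl | refl = f≰t

  replaceByF-join : b ∈ T → IsJoin L (replaceByF T) j → IsJoin L T j
  replaceByF-join {T = T} {j = j} b∈T (T′≤j , j-least) = T≤j , λ u T≤u → j-least u (T′≤ u T≤u)
    where
    T≤j : UpperBound T j
    T≤j t t∈T with t ≟ b
    ... | no t≢b  = T′≤j t (∈-replaceByF⁺ˡ t∈T t≢b)
    ... | yes refl = proj₂ F-join j λ f f∈F → f≤j f f∈F (any? λ u → u ∈? (T - b) ×-dec f ≤? u)
      where
      f≤j : ∀ f → f ∈ F → Dec (∃ λ u → u ∈ T - b × f ≤ u) → f ≤ j
      f≤j f f∈F (yes (u , u∈ , f≤u)) = ≤-trans f≤u (T′≤j u (x∈p∪q⁺ (inj₁ u∈)))
      f≤j f f∈F (no ∄u) = T′≤j f (∈-replaceByF⁺ʳ (f∈F , λ u u∈ f≤u → ∄u (u , u∈ , f≤u)))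
    T′≤ : ∀ u → UpperBound T u → UpperBound (replaceByF T) u
    T′≤ u T≤u x x∈ with ∈-replaceByF⁻ x∈
    ... | inj₁ (x∈T , _) = T≤u x x∈T
    ... | inj₂ (x∈F , _) = ≤-trans (F≤b x∈F) (T≤u b b∈T)

  expand-Nested₁⇒Nested₂ : b ∈ U → Nested₁ (expand U) → ¬ F ⊆ U → Nested₂ U
  expand-Nested₁⇒Nested₂ {U = U} b∈U V-nested F⊈U = mkNested U⊆G₂ joins
    where
    U⊆G₂ : U ⊆ G₂
    U⊆G₂ {x} x∈U with x ≟ b
    ... | yes refl = b∈G₂
    ... | no x≢b   = G₁⊆G₂ (proj₁ V-nested (∈-expand⁺ˡ x∈U x≢b))
    joins : NestedJoins G₂ U
    joins T T⊆U T≥2 T-anti with b ∈? T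
    ... | no b∉T with IsNested-joins V-nested T (⊆-expand T⊆U b∉T) T≥2 T-anti
    ...   | j , T-join , j∉G₁ = j , T-join , ∉G₂ j∉G₁ λ { refl →
      F⊈U λ f∈F → T⊆U (join≡b⇒F⊆ V-nested (⊆-expand T⊆U b∉T) T-anti T-join f∈F) }
    joins T T⊆U T≥2 T-anti | yes b∈T
      with IsNested-joins V-nested (replaceByF T) (replaceByF-⊆ T⊆U)
             (replaceByF-atLeastTwo b∈T T≥2 T-anti) (replaceByF-antichain b∈T T-anti)
    ...   | j , T′-join , j∉G₁ = j , T-join , ∉G₂ j∉G₁ λ { refl →
      antichain-join≰member T≥2 T-anti T-join b∈T ≤-refl }
      where
      T-join : IsJoin L T j
      T-join = replaceByF-join b∈T T′-join

  notBelowB? : ∀ T → Decidable (λ x → x ∈ T × ¬ x ≤ b)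
  notBelowB? T x = x ∈? T ×-dec ¬? (x ≤? b)

  aboveB : Subset N → Subset N
  aboveB T = select (notBelowB? T) ∪ ⁅ b ⁆

  ∈-aboveB⁺ : x ∈ T → ¬ x ≤ b → x ∈ aboveB T
  ∈-aboveB⁺ {T = T} x∈T x≰b = x∈p∪q⁺ (inj₁ (∈-select⁺ (notBelowB? T) (x∈T , x≰b)))

  b∈aboveB : b ∈ aboveB T
  b∈aboveB = y∈p∪⁅y⁆ _ b

  ∈-aboveB⁻ : x ∈ aboveB T → (x ∈ T × ¬ x ≤ b) ⊎ x ≡ b
  ∈-aboveB⁻ {T = T} x∈ with x∈p∪⁅y⁆⁻ _ x∈
  ... | inj₁ x∈sel = inj₁ (∈-select⁻ (notBelowB? T) x∈sel)
  ... | inj₂ x≡b   = inj₂ x≡b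

  aboveB-⊆ : b ∈ U → T ⊆ expand U → aboveB T ⊆ U
  aboveB-⊆ b∈U T⊆V x∈ with ∈-aboveB⁻ x∈
  ... | inj₂ refl = b∈U
  ... | inj₁ (x∈T , x≰b) with ∈-expand⁻ (T⊆V x∈T)
  ...   | inj₁ (x∈U , _) = x∈U
  ...   | inj₂ x∈F       = ⊥-elim (x≰b (F≤b x∈F))

  aboveB-antichain : ∀ {f₀} → f₀ ∈ T → f₀ ∈ F → Antichain T → Antichain (aboveB T)
  aboveB-antichain f₀∈T f₀∈F T-anti x y x∈ y∈ x≢y x≤y with ∈-aboveB⁻ x∈ | ∈-aboveB⁻ y∈
  ... | inj₁ (x∈T , _)   | inj₁ (y∈T , _)   = T-anti x y x∈T y∈T x≢y x≤y
  ... | inj₁ (_ , x≰b)   | inj₂ refl        = x≰b x≤y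
  ... | inj₂ refl        | inj₁ (y∈T , y≰b) =
    T-anti _ y f₀∈T y∈T (λ { refl → y≰b (F≤b f₀∈F) }) (≤-trans (F≤b f₀∈F) x≤y)
  ... | inj₂ refl        | inj₂ refl        = x≢y refl

  aboveB-atLeastTwo : ∀ {t} → t ∈ T → ¬ t ≤ b → AtLeastTwo (aboveB T)
  aboveB-atLeastTwo t∈T t≰b = _ , b , ∈-aboveB⁺ t∈T t≰b , b∈aboveB , λ { refl → t≰b ≤-refl }

  join-aboveB-upper : ∀ {p} → IsJoin L (aboveB T) p → UpperBound T p
  join-aboveB-upper (T′≤p , _) x x∈T with x ≤? b
  ... | yes x≤b = ≤-trans x≤b (T′≤p b b∈aboveB)
  ... | no x≰b  = T′≤p x (∈-aboveB⁺ x∈T x≰b)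

  join≤b∉G₁ : ∀ {f₀} → AtLeastTwo T → Antichain T → f₀ ∈ T → f₀ ∈ F → IsJoin L T j → j ≤ b → j ∉ G₁
  join≤b∉G₁ T≥2 T-anti f₀∈T f₀∈F T-join j≤b j∈G₁ with InF-above j∈G₁ j≤b
  ... | f , f-InF , j≤f with InF-maximal (to (F⇔ _) f₀∈F) f-InF (≤-trans (proj₁ T-join _ f₀∈T) j≤f)
  ...   | refl = antichain-join≰member T≥2 T-anti T-join f₀∈T j≤f

  -- The antichain aboveB T of the G₂-nested set U has a join p ∉ G₂, and an element
  -- of G₁ above the join of T would sit below an element of F_{G₂}(p) ⊆ aboveB T.
  join≰b∉G₁ : ∀ {f₀ t} → Nested₂ U → b ∈ U → T ⊆ expand U → AtLeastTwo T → Antichain T →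
              f₀ ∈ T → f₀ ∈ F → t ∈ T → ¬ t ≤ b → ∃ λ j → IsJoin L T j × j ∉ G₁
  join≰b∉G₁ U-nested b∈U T⊆V T≥2 T-anti f₀∈T f₀∈F t∈T t≰b
    with IsNested-joins U-nested _ (aboveB-⊆ b∈U T⊆V) (aboveB-atLeastTwo t∈T t≰b)
                        (aboveB-antichain f₀∈T f₀∈F T-anti)
  ... | p , T′-join , _ with boundedJoin _ p (join-aboveB-upper T′-join)
  ...   | j , T-join , j≤p = j , T-join , j∉G₁
    where
    j∉G₁ : j ∉ G₁
    j∉G₁ j∈G₁ with InF-above (G₁⊆G₂ j∈G₁) j≤p
    ... | g , g-InF , j≤g with ∈-aboveB⁻ (InF-join∈ G₂-building U-nested (aboveB-⊆ b∈U T⊆V)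
                                            (aboveB-antichain f₀∈T f₀∈F T-anti) T′-join g-InF)
    ...   | inj₁ (g∈T , _) = antichain-join≰member T≥2 T-anti T-join g∈T j≤g
    ...   | inj₂ refl      = t≰b (≤-trans (proj₁ T-join _ t∈T) j≤g)

  Nested₂⇒expand-Nested₁ : Nested₂ U → b ∈ U → Nested₁ (expand U)
  Nested₂⇒expand-Nested₁ {U = U} U-nested b∈U = mkNested (Nested₂⇒expand⊆G₁ U-nested) joins
    where
    joins : NestedJoins G₁ (expand U)
    joins T T⊆V T≥2 T-anti with any? (λ x → x ∈? T ×-dec x ∈? F)
    ... | no ∄f₀ with IsNested-joins U-nested T T⊆U T≥2 T-anti
      where
      T⊆U : T ⊆ U
      T⊆U {x} x∈T with ∈-expand⁻ (T⊆V x∈T)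
      ... | inj₁ (x∈U , _) = x∈U
      ... | inj₂ x∈F       = ⊥-elim (∄f₀ (x , x∈T , x∈F))
    ...   | j , T-join , j∉G₂ = j , T-join , λ j∈G₁ → j∉G₂ (G₁⊆G₂ j∈G₁)
    joins T T⊆V T≥2 T-anti | yes (f₀ , f₀∈T , f₀∈F) with any? (λ x → x ∈? T ×-dec ¬? (x ≤? b))
    ... | yes (t , t∈T , t≰b) = join≰b∉G₁ U-nested b∈U T⊆V T≥2 T-anti f₀∈T f₀∈F t∈T t≰b
    ... | no ∄t with boundedJoin T b (λ x x∈T → decidable-stable (x ≤? b) λ x≰b → ∄t (x , x∈T , x≰b))
    ...   | j , T-join , j≤b = j , T-join , join≤b∉G₁ T≥2 T-anti f₀∈T f₀∈F T-join j≤b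

  Max₁ Max₂ : Subset N → Subset N → Set
  Max₁ = IsMaxNestedAbove L G₁
  Max₂ = IsMaxNestedAbove L G₂

  exchange : Subset N → Fin N → Subset N
  exchange M f = (M - f) ∪ ⁅ b ⁆

  ∈-exchange⁺ : x ∈ M → x ≢ f → x ∈ exchange M f
  ∈-exchange⁺ x∈M x≢f = x∈p∪q⁺ (inj₁ (x∈p∧x≢y⇒x∈p-y x∈M x≢f))

  b∈exchange : b ∈ exchange M f
  b∈exchange = y∈p∪⁅y⁆ _ b

  ∈-exchange⁻ : x ∈ exchange M f → (x ∈ M × x ≢ f) ⊎ x ≡ b
  ∈-exchange⁻ {M = M} x∈ with x∈p∪⁅y⁆⁻ (M - _) x∈
  ... | inj₁ x∈M-f = inj₁ (x∈p-y⁻ M x∈M-f)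
  ... | inj₂ x≡b   = inj₂ x≡b

  f∉exchange : f ∈ F → f ∉ exchange M f
  f∉exchange f∈F f∈ with ∈-exchange⁻ f∈
  ... | inj₁ (_ , f≢f) = f≢f refl
  ... | inj₂ f≡b       = F∌b f∈F f≡b

  expand-least : (∀ {x} → x ∈ V → x ≢ b → x ∈ W) → F ⊆ W → expand V ⊆ W
  expand-least V-b⊆W F⊆W x∈ with ∈-expand⁻ x∈
  ... | inj₁ (x∈V , x≢b) = V-b⊆W x∈V x≢b
  ... | inj₂ x∈F         = F⊆W x∈F

  expand-exchange⊆ : F ⊆ M → expand (exchange M f) ⊆ M
  expand-exchange⊆ F⊆M =
    expand-least (λ x∈ x≢b → [ proj₁ , (λ x≡b → ⊥-elim (x≢b x≡b)) ]′ (∈-exchange⁻ x∈)) F⊆M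

  Nested₂-from-expand : b ∈ V → expand V ⊆ W → Nested₁ W → f ∈ F → f ∉ V → Nested₂ V
  Nested₂-from-expand b∈V V′⊆W W-nested f∈F f∉V =
    expand-Nested₁⇒Nested₂ b∈V (IsNested-⊆ W-nested V′⊆W) λ F⊆V → f∉V (F⊆V f∈F)

  Max₂-b∉ : Max₂ S T → b ∉ T → Max₁ S T × ¬ F ⊆ T
  Max₂-b∉ {T = T} (T-nested , S⊆T , T-max) b∉T =
    (Nested₂⇒Nested₁ T-nested b∉T , S⊆T , T-max₁) , Nested₂⇒F⊈ T-nested
    where
    T-max₁ : ∀ U → Nested₁ U → T ⊆ U → U ≡ T
    T-max₁ U U-nested T⊆U with F ⊆? U
    ... | no F⊈U = T-max U (Nested₁⇒Nested₂ U-nested F⊈U) T⊆U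
    ... | yes F⊆U with ⊈⇒∃∉ (Nested₂⇒F⊈ T-nested)
    ...   | f , f∈F , f∉T = ⊥-elim (b∉T (subst (b ∈_) T∪⁅b⁆≡T (y∈p∪⁅y⁆ T b)))
      where
      T∪⁅b⁆≡T : T ∪ ⁅ b ⁆ ≡ T
      T∪⁅b⁆≡T = T-max (T ∪ ⁅ b ⁆)
        (Nested₂-from-expand (y∈p∪⁅y⁆ T b)
          (expand-least (λ x∈ x≢b → [ T⊆U , (λ x≡b → ⊥-elim (x≢b x≡b)) ]′ (x∈p∪⁅y⁆⁻ T x∈)) F⊆U)
          U-nested f∈F
          λ f∈ → [ f∉T , F∌b f∈F ]′ (x∈p∪⁅y⁆⁻ T f∈))
        (p⊆p∪q ⁅ b ⁆)

  Max₁⇒Max₂ : Max₁ S T → ¬ F ⊆ T → Max₂ S T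
  Max₁⇒Max₂ {T = T} (T-nested , S⊆T , T-max) F⊈T = Nested₁⇒Nested₂ T-nested F⊈T , S⊆T , T-max₂
    where
    T-max₂ : ∀ U → Nested₂ U → T ⊆ U → U ≡ T
    T-max₂ U U-nested T⊆U with b ∈? U
    ... | no b∉U  = T-max U (Nested₂⇒Nested₁ U-nested b∉U) T⊆U
    ... | yes b∈U = ⊥-elim (F⊈T λ f∈F → subst (_ ∈_) expandU≡T (∈-expand⁺ʳ f∈F))
      where
      expandU≡T : expand U ≡ T
      expandU≡T = T-max (expand U) (Nested₂⇒expand-Nested₁ U-nested b∈U)
                    (λ x∈T → ∈-expand⁺ˡ (T⊆U x∈T) λ { refl → b∉Nested₁ T-nested x∈T })

  Max₂-misses-one : Max₂ S T → b ∈ T → f ∈ F → f ∉ T → ∀ {f′} → f′ ∈ F → f′ ∉ T → f′ ≡ f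
  Max₂-misses-one {T = T} {f = f} (T-nested , _ , T-max) b∈T f∈F f∉T {f′} f′∈F f′∉T =
    decidable-stable (f′ ≟ f) λ f′≢f → f′∉T (subst (f′ ∈_) (T∪⁅f′⁆≡T f′≢f) (y∈p∪⁅y⁆ T f′))
    where
    T∪⁅f′⁆≡T : f′ ≢ f → T ∪ ⁅ f′ ⁆ ≡ T
    T∪⁅f′⁆≡T f′≢f = T-max (T ∪ ⁅ f′ ⁆)
      (Nested₂-from-expand (x∈p∪q⁺ (inj₁ b∈T))
        (expand-least (λ x∈ x≢b → [ (λ x∈T → ∈-expand⁺ˡ x∈T x≢b) , (λ { refl → ∈-expand⁺ʳ f′∈F }) ]′
                                   (x∈p∪⁅y⁆⁻ T x∈))
                      ∈-expand⁺ʳ)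
        (Nested₂⇒expand-Nested₁ T-nested b∈T) f∈F
        λ f∈ → [ f∉T , (λ f≡f′ → f′≢f (sym f≡f′)) ]′ (x∈p∪⁅y⁆⁻ T f∈))
      (p⊆p∪q ⁅ f′ ⁆)

  expand-mono : S ⊆ T → expand S ⊆ expand T
  expand-mono S⊆T = expand-least (λ x∈S x≢b → ∈-expand⁺ˡ (S⊆T x∈S) x≢b) ∈-expand⁺ʳ

  Max₂-b∈-expand : Max₂ S T → b ∈ T → f ∈ F → f ∉ T → Max₁ (expand S) (expand T)
  Max₂-b∈-expand {T = T} {f = f} T-max₂@(T-nested , S⊆T , T-max) b∈T f∈F f∉T =
    Nested₂⇒expand-Nested₁ T-nested b∈T , expand-mono S⊆T , expandT-max
    where
    expandT-max : ∀ U → Nested₁ U → expand T ⊆ U → U ≡ expand T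
    expandT-max U U-nested T′⊆U = ⊆-antisym U⊆T′ T′⊆U
      where
      exchangeU≡T : exchange U f ≡ T
      exchangeU≡T = T-max (exchange U f)
        (Nested₂-from-expand b∈exchange (expand-exchange⊆ (λ f∈F → T′⊆U (∈-expand⁺ʳ f∈F)))
                             U-nested f∈F (f∉exchange f∈F))
        T⊆exchangeU
        where
        T⊆exchangeU : T ⊆ exchange U f
        T⊆exchangeU {x} x∈T with x ≟ b
        ... | yes refl = b∈exchange
        ... | no x≢b   = ∈-exchange⁺ (T′⊆U (∈-expand⁺ˡ x∈T x≢b)) λ { refl → f∉T x∈T }
      U⊆T′ : U ⊆ expand T
      U⊆T′ {x} x∈U with x ≟ f
      ... | yes refl = ∈-expand⁺ʳ f∈F
      ... | no x≢f   =
        ∈-expand⁺ˡ (subst (x ∈_) exchangeU≡T (∈-exchange⁺ x∈U x≢f)) λ { refl → b∉Nested₁ U-nested x∈U }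

  exchange-expand : b ∈ T → f ∉ T → (∀ {f′} → f′ ∈ F → f′ ∉ T → f′ ≡ f) → T ≡ exchange (expand T) f
  exchange-expand {T = T} {f = f} b∈T f∉T F-T=⁅f⁆ = ⊆-antisym T⊆ ⊆T
    where
    T⊆ : T ⊆ exchange (expand T) f
    T⊆ {x} x∈T with x ≟ b
    ... | yes refl = b∈exchange
    ... | no x≢b   = ∈-exchange⁺ (∈-expand⁺ˡ x∈T x≢b) λ { refl → f∉T x∈T }
    ⊆T : exchange (expand T) f ⊆ T
    ⊆T {x} x∈ with ∈-exchange⁻ x∈
    ... | inj₂ refl = b∈T
    ... | inj₁ (x∈T′ , x≢f) with ∈-expand⁻ x∈T′
    ...   | inj₁ (x∈T , _) = x∈T
    ...   | inj₂ x∈F       = decidable-stable (x ∈? T) λ x∉T → x≢f (F-T=⁅f⁆ x∈F x∉T)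

  Exchanged : Subset N → Subset N → Set
  Exchanged S T = ∃ λ ((M , f) : Subset N × Fin N) → (Max₁ (expand S) M × f ∈ F ─ S) × T ≡ exchange M f

  Max₂-b∈ : Max₂ S T → b ∈ T → Exchanged S T
  Max₂-b∈ T-max₂@(T-nested , S⊆T , _) b∈T with ⊈⇒∃∉ (Nested₂⇒F⊈ T-nested)
  ... | f , f∈F , f∉T =
    (_ , f) , (Max₂-b∈-expand T-max₂ b∈T f∈F f∉T , x∈p∧x∉q⇒x∈p─q f∈F (λ f∈S → f∉T (S⊆T f∈S))) ,
    exchange-expand b∈T f∉T (Max₂-misses-one T-max₂ b∈T f∈F f∉T)

  Max₁-expand⇒Max₂ : Max₁ (expand S) M → f ∈ F ─ S → Max₂ S (exchange M f)
  Max₁-expand⇒Max₂ {S = S} {M = M} {f = f} (M-nested , S′⊆M , M-max) f∈F─S =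
    Nested₂-from-expand b∈exchange (expand-exchange⊆ F⊆M) M-nested f∈F (f∉exchange f∈F) , S⊆T , T-max
    where
    f∈F : f ∈ F
    f∈F = proj₁ (x∈p─q⁻ F S f∈F─S)
    f∉S : f ∉ S
    f∉S = proj₂ (x∈p─q⁻ F S f∈F─S)
    F⊆M : F ⊆ M
    F⊆M f∈F = S′⊆M (∈-expand⁺ʳ f∈F)
    S⊆T : S ⊆ exchange M f
    S⊆T {x} x∈S with x ≟ b
    ... | yes refl = b∈exchange
    ... | no x≢b   = ∈-exchange⁺ (S′⊆M (∈-expand⁺ˡ x∈S x≢b)) λ { refl → f∉S x∈S }
    T-max : ∀ U → Nested₂ U → exchange M f ⊆ U → U ≡ exchange M f
    T-max U U-nested T⊆U = ⊆-antisym U⊆T T⊆U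
      where
      b∈U : b ∈ U
      b∈U = T⊆U b∈exchange
      expandU≡M : expand U ≡ M
      expandU≡M = M-max (expand U) (Nested₂⇒expand-Nested₁ U-nested b∈U) M⊆U′
        where
        M⊆U′ : M ⊆ expand U
        M⊆U′ {x} x∈M with x ≟ f
        ... | yes refl = ∈-expand⁺ʳ f∈F
        ... | no x≢f   = ∈-expand⁺ˡ (T⊆U (∈-exchange⁺ x∈M x≢f)) λ { refl → b∉Nested₁ M-nested x∈M }
      f∉U : f ∉ U
      f∉U with ⊈⇒∃∉ (Nested₂⇒F⊈ U-nested)
      ... | f′ , f′∈F , f′∉U with f′ ≟ f
      ...   | yes refl = f′∉U
      ...   | no f′≢f  = ⊥-elim (f′∉U (T⊆U (∈-exchange⁺ (F⊆M f′∈F) f′≢f)))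
      U⊆T : U ⊆ exchange M f
      U⊆T {x} x∈U with x ≟ b
      ... | yes refl = b∈exchange
      ... | no x≢b   = ∈-exchange⁺ (subst (x ∈_) expandU≡M (∈-expand⁺ˡ x∈U x≢b)) λ { refl → f∉U x∈U }

  exchange-injective : F ⊆ M → b ∉ M → F ⊆ W → b ∉ W → ∀ {f f′} → f ∈ F → f′ ∈ F →
                       exchange M f ≡ exchange W f′ → M ≡ W × f ≡ f′
  exchange-injective F⊆M b∉M F⊆W b∉W {f} {f′} f∈F f′∈F M↦≡W↦ with f ≟ f′
  ... | no f≢f′  = ⊥-elim (f∉exchange f∈F (subst (f ∈_) (sym M↦≡W↦) (∈-exchange⁺ (F⊆W f∈F) f≢f′)))
  ... | yes refl = ⊆-antisym (recover M↦≡W↦ (F⊆W f∈F) b∉M) (recover (sym M↦≡W↦) (F⊆M f∈F) b∉W) , refl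
    where
    recover : ∀ {X Y} → exchange X f ≡ exchange Y f → f ∈ Y → b ∉ X → X ⊆ Y
    recover X↦≡Y↦ f∈Y b∉X {x} x∈X with x ≟ f
    ... | yes refl = f∈Y
    ... | no x≢f with ∈-exchange⁻ (subst (x ∈_) X↦≡Y↦ (∈-exchange⁺ x∈X x≢f))
    ...   | inj₁ (x∈Y , _) = x∈Y
    ...   | inj₂ refl      = ⊥-elim (b∉X x∈X)

  Exchanged-card : ∀ {c} → χ≡ L G₁ (expand S) c → HasCard (Exchanged S) (c * ∣ F ─ S ∣)
  Exchanged-card {S = S} χ =
    HasCardIn-image (uncurry exchange) injective (HasCardIn-× χ (HasCardIn-∈ (F ─ S)))
    where
    injective : ∀ {Mf Wf′} → Max₁ (expand S) (proj₁ Mf) × proj₂ Mf ∈ F ─ S →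
                Max₁ (expand S) (proj₁ Wf′) × proj₂ Wf′ ∈ F ─ S →
                uncurry exchange Mf ≡ uncurry exchange Wf′ → Mf ≡ Wf′
    injective ((M-nested , S′⊆M , _) , f∈F─S) ((W-nested , S′⊆W , _) , f′∈F─S) M↦≡W↦ =
      let M≡W , f≡f′ = exchange-injective (λ g∈F → S′⊆M (∈-expand⁺ʳ g∈F)) (b∉Nested₁ M-nested)
                                          (λ g∈F → S′⊆W (∈-expand⁺ʳ g∈F)) (b∉Nested₁ W-nested)
                                          (proj₁ (x∈p─q⁻ F S f∈F─S)) (proj₁ (x∈p─q⁻ F S f′∈F─S)) M↦≡W↦
      in cong₂ _,_ M≡W f≡f′

  Exchanged⇒Max₂ : Exchanged S T → Max₂ S T
  Exchanged⇒Max₂ ((M , f) , (M-max , f∈F─S) , refl) = Max₁-expand⇒Max₂ M-max f∈F─S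

  Max₂⇔Exchanged : b ∈ S → ∀ T → Max₂ S T ⇔ Exchanged S T
  Max₂⇔Exchanged b∈S T = mk⇔ (λ T-max → Max₂-b∈ T-max (proj₁ (proj₂ T-max) b∈S)) Exchanged⇒Max₂

  Max₁⇔ : ∀ T → Max₁ S T ⇔ ((Max₁ S T × ¬ F ⊆ T) ⊎ Max₁ (S ∪ F) T)
  Max₁⇔ {S = S} T = mk⇔ split [ proj₁ , above-S∪F⇒above-S ]′
    where
    above-S∪F⇒above-S : Max₁ (S ∪ F) T → Max₁ S T
    above-S∪F⇒above-S (T-nested , S∪F⊆T , T-max) = T-nested , (λ x∈S → S∪F⊆T (p⊆p∪q F x∈S)) , T-max
    split : Max₁ S T → (Max₁ S T × ¬ F ⊆ T) ⊎ Max₁ (S ∪ F) T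
    split T-max@(T-nested , S⊆T , T-maximal) with F ⊆? T
    ... | no F⊈T  = inj₁ (T-max , F⊈T)
    ... | yes F⊆T = inj₂ (T-nested , (λ x∈ → [ S⊆T , F⊆T ]′ (x∈p∪q⁻ S F x∈)) , T-maximal)

  Max₂⇔ : b ∉ S → ∀ T → Max₂ S T ⇔ ((Max₁ S T × ¬ F ⊆ T) ⊎ Exchanged S T)
  Max₂⇔ b∉S T = mk⇔ split [ uncurry Max₁⇒Max₂ , Exchanged⇒Max₂ ]′
    where
    split : Max₂ S T → (Max₁ S T × ¬ F ⊆ T) ⊎ Exchanged S T
    split T-max with b ∈? T
    ... | no b∉T  = inj₁ (Max₂-b∉ T-max b∉T)
    ... | yes b∈T = inj₂ (Max₂-b∈ T-max b∈T)

  b∉⇒expand≡∪ : b ∉ S → expand S ≡ S ∪ F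
  b∉⇒expand≡∪ {S = S} b∉S =
    cong (_∪ F) (⊆-antisym (p─q⊆p S ⁅ b ⁆) λ x∈S → x∈p∧x≢y⇒x∈p-y x∈S λ { refl → b∉S x∈S })

  χ-decompose : ∀ {a c} → b ∉ S → HasCard (λ T → Max₁ S T × ¬ F ⊆ T) a → χ≡ L G₁ (S ∪ F) c →
         χ≡ L G₁ S (a + c) × χ≡ L G₂ S (a + c * ∣ F ─ S ∣)
  χ-decompose b∉S χ⊉F χ∪F =
    HasCardIn-cong (λ T → ⇔-sym (Max₁⇔ T))
      (HasCardIn-⊎ (λ T (_ , F⊈T) (_ , S∪F⊆T , _) → F⊈T λ f∈F → S∪F⊆T (x∈p∪q⁺ (inj₂ f∈F))) χ⊉F χ∪F) ,
    HasCardIn-cong (λ T → ⇔-sym (Max₂⇔ b∉S T))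
      (HasCardIn-⊎ (λ { T ((T-nested , _) , _) (_ , _ , refl) → b∉Nested₁ T-nested b∈exchange }) χ⊉F
        (Exchanged-card (subst (λ X → χ≡ L G₁ X _) (sym (b∉⇒expand≡∪ b∉S)) χ∪F)))

  private
    Max₁⊉F? : ∀ S T → Dec (Max₁ S T × ¬ F ⊆ T)
    Max₁⊉F? S T = IsMaxNestedAbove? G₁ S T ×-dec ¬? (F ⊆? T)

  χ-unchanged : b ∉ S → ¬ Nested₁ (S ∪ F) → ∃ λ k → χ≡ L G₂ S k × χ≡ L G₁ S k
  χ-unchanged {S = S} b∉S S∪F-not-nested
    with hasCard (Max₁⊉F? S) | hasCard (IsMaxNestedAbove? G₁ (S ∪ F))
  ... | a , χ⊉F | c , χ∪F
    with HasCardIn-empty (λ T (T-nested , S∪F⊆T , _) → S∪F-not-nested (IsNested-⊆ T-nested S∪F⊆T)) χ∪F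
  ... | refl = let χ₁ , χ₂ = χ-decompose b∉S χ⊉F χ∪F
               in a , subst (χ≡ L G₂ S) (+-identityʳ a) χ₂ , subst (χ≡ L G₁ S) (+-identityʳ a) χ₁

  χ-increment : Nested₂ S → b ∉ S → ∃₂ λ k₂ k₁ → ∃ λ c →
                χ≡ L G₂ S k₂ × χ≡ L G₁ S k₁ × χ≡ L G₁ (S ∪ F) c × k₂ ≡ k₁ + c * (∣ F ─ S ∣ ∸ 1)
  χ-increment {S = S} S-nested b∉S
    with hasCard (Max₁⊉F? S) | hasCard (IsMaxNestedAbove? G₁ (S ∪ F)) | ⊈⇒∃∉ (Nested₂⇒F⊈ S-nested)
  ... | a , χ⊉F | c , χ∪F | f , f∈F , f∉S =
    let χ₁ , χ₂ = χ-decompose b∉S χ⊉F χ∪F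
    in _ , _ , c , χ₂ , χ₁ , χ∪F , a+c*s≡a+c+c*[s∸1] a c _ (x∈p⇒∣p∣≥1 (x∈p∧x∉q⇒x∈p─q f∈F f∉S))

  χ-with-b : b ∈ S → ∃₂ λ k₂ c → χ≡ L G₂ S k₂ × χ≡ L G₁ (expand S) c × k₂ ≡ c * ∣ F ─ S ∣
  χ-with-b {S = S} b∈S with hasCard (IsMaxNestedAbove? G₁ (expand S))
  ... | c , χ = _ , c , HasCardIn-cong (λ T → ⇔-sym (Max₂⇔Exchanged b∈S T)) (Exchanged-card χ) , χ , refl

theorem4 : (L : FiniteMeetSemilattice) (G₁ : Subset (n L)) (b : Fin (n L)) →
    IsBuildingSet L G₁ → b ∉ G₁ → IsBuildingSet L (G₁ ∪ ⁅ b ⁆) →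
    (F : Subset (n L)) → (∀ g → g ∈ F ⇔ InF L G₁ b g) →
    (S : Subset (n L)) → IsNested L (G₁ ∪ ⁅ b ⁆) S →
      (b ∉ S → ¬ IsNested L G₁ (S ∪ F) →
        Σ ℕ λ k → χ≡ L (G₁ ∪ ⁅ b ⁆) S k × χ≡ L G₁ S k)
    × (b ∉ S → IsNested L G₁ (S ∪ F) →
        Σ ℕ λ k₂ → Σ ℕ λ k₁ → Σ ℕ λ c →
          χ≡ L (G₁ ∪ ⁅ b ⁆) S k₂ × χ≡ L G₁ S k₁ × χ≡ L G₁ (S ∪ F) c
          × k₂ ≡ k₁ + c * (∣ F ─ S ∣ ∸ 1))
    × (b ∈ S →
        Σ ℕ λ k₂ → Σ ℕ λ c →
          χ≡ L (G₁ ∪ ⁅ b ⁆) S k₂ × χ≡ L G₁ ((S - b) ∪ F) c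
          × k₂ ≡ c * ∣ F ─ S ∣)
-- The second formula holds without S ∪ F being G₁-nested: then χ_{G₁}(S ∪ F) = 0.
theorem4 L G₁ b G₁-building b∉G₁ G₂-building F F⇔ S S-nested =
  χ-unchanged , (λ b∉S _ → χ-increment S-nested b∉S) , χ-with-b
  where open Extension L G₁-building b∉G₁ G₂-building F⇔
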